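{- Let $k \ge 1$ be an integer, let $G$ be a directed graph, and let $W_1, W_2 \subseteq V(G)$ be disjoint sets with $|W_1|, |W_2| \ge 2k$ forming a $k$-regular pair, meaning: for all $X_1 \subseteq W_1$ and $X_2 \subseteq W_2$ with $|X_1| \ge |W_1|/20$ and $|X_2| \ge |W_2|/20$, the number of edges of $G$ directed from $X_1$ to $X_2$ is at least $|X_1||X_2|/10$, and the number of edges of $G$ directed from $X_2$ to $X_1$ is at least $|X_1||X_2|/10$. Then for each $i \in \{1,2\}$ there is a directed path in $G$ with $2k$ edges (on distinct vertices) whose first vertex lies in $W_i$. -}

module Defs where

open import Data.Nat using (ℕ; zero; suc; _+_; _*_; _≤_)
open import Data.Bool using (Bool; true; false; _∧_; T)
open import Data.Fin using (Fin)
open import Data.Fin.Subset using (Subset; _∈_; _∉_; _⊆_; ∣_∣)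
open import Data.List using (List; map; allFin; foldr)
open import Data.Vec using (Vec; lookup)
open import Data.Fin using (zero; suc; inject₁)
open import Function.Definitions using (Injective)
open import Data.Product using (_×_)
open import Relation.Binary.PropositionalEquality using (_≡_)

record DiGraph (n : ℕ) : Set where
  field
    adj : Fin n → Fin n → Bool

open DiGraph public

∑ : ∀ {n} → (Fin n → ℕ) → ℕ
∑ {n} f = foldr _+_ 0 (map f (allFin n))

𝟙 : Bool → ℕ
𝟙 true  = 1
𝟙 false = 0

edgesFromTo : ∀ {n} → DiGraph n → Subset n → Subset n → ℕ
edgesFromTo G X₁ X₂ =
  ∑ (λ u → ∑ (λ v → 𝟙 (lookup X₁ u ∧ lookup X₂ v ∧ adj G u v)))

Disjoint : ∀ {n} → Subset n → Subset n → Set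
Disjoint {n} A B = (v : Fin n) → v ∈ A → v ∉ B


-- (W₁ , W₂) is a k-regular pair in G: for all X₁ ⊆ W₁, X₂ ⊆ W₂ with
-- |X₁| ≥ |W₁|/20 and |X₂| ≥ |W₂|/20, both e(X₁,X₂) and e(X₂,X₁) are at
-- least |X₁||X₂|/10.  The rational inequalities are cleared of
-- denominators:  a ≥ b/20  ⇔  b ≤ 20·a,   e ≥ c/10  ⇔  c ≤ 10·e.
-- (The definition does not depend on k; k only enters via |Wᵢ| ≥ 2k.)
IsRegularPair : ∀ {n} → DiGraph n → Subset n → Subset n → Set
IsRegularPair G W₁ W₂ =
  ∀ (X₁ X₂ : Subset _) → X₁ ⊆ W₁ → X₂ ⊆ W₂ →
  ∣ W₁ ∣ ≤ 20 * ∣ X₁ ∣ → ∣ W₂ ∣ ≤ 20 * ∣ X₂ ∣ →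
  (∣ X₁ ∣ * ∣ X₂ ∣ ≤ 10 * edgesFromTo G X₁ X₂) ×
  (∣ X₁ ∣ * ∣ X₂ ∣ ≤ 10 * edgesFromTo G X₂ X₁)

record DiPath {n} (G : DiGraph n) (m : ℕ) : Set where
  field
    vertex   : Fin (suc m) → Fin n
    distinct : Injective _≡_ _≡_ vertex
    edges    : (j : Fin m) → T (adj G (vertex (inject₁ j)) (vertex (suc j)))

open DiPath public

start : ∀ {n} {G : DiGraph n} {m} → DiPath G m → Fin n
start p = vertex p zero

module Submission where

-- Run depth-first search in the subgraph of G formed by the edges between W₁ and W₂,
-- growing the stack backwards (a new top is an in-neighbour of the old one), so the
-- stack is always a path starting at its top.  If the stack reaches 2k+2 vertices, its
-- top two vertices, which lie on opposite sides, start the two required paths.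
-- Otherwise consider the first time the set S of finished vertices fills a twentieth of
-- a side W, at the finishing of some x ∈ W.  No edge goes from an unvisited vertex into
-- S ∪ {x}, while on the other side W′ the stack has at most k vertices (it alternates
-- and has x on top) and S is still below a twentieth; so the unvisited vertices fill a
-- twentieth of W′, and regularity provides an edge from them into S ∪ {x}, which is absurd.

open import Defs
open import Data.Bool using (Bool; true; false; not; T; _∧_; _∨_)
open import Data.Bool.Properties using (T-∧; T-∨; T?; not-involutive)
open import Data.Empty using (⊥; ⊥-elim)
open import Data.Fin using (Fin; zero; suc; inject₁)
open import Data.Fin.Properties using (any?)
open import Data.Fin.Subset
  using (Subset; inside; outside; ⁅_⁆; _∪_; _∩_; ∁; _∈_; _∉_; _⊆_; ∣_∣)
  renaming (⊥ to ∅)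
open import Data.Fin.Subset.Properties
open import Data.List using (List; []; _∷_; length; foldr; map; allFin)
open import Data.List.Membership.Propositional using () renaming (_∈_ to _∈ₗ_)
open import Data.List.Relation.Unary.All as All using (All; []; _∷_)
open import Data.List.Relation.Unary.Any using (here; there)
open import Data.List.Relation.Unary.AllPairs as AllPairs using ([]; _∷_)
open import Data.List.Relation.Unary.Linked as Linked using (Linked; []; [-]; _∷_)
open import Data.List.Relation.Unary.Unique.Propositional using (Unique)
open import Data.Nat using (ℕ; zero; suc; _+_; _*_; _≤_; _<_; z≤n; s≤s; z<s; _<?_)
open import Data.Nat.Properties
open import Data.Nat.Induction using (<-wellFounded)
open import Data.Nat.Tactic.RingSolver using (solve-∀)
open import Data.Product using (Σ; _×_; _,_; proj₁; proj₂; ∃-syntax; Σ-syntax)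
open import Data.Sum using (_⊎_; inj₁; inj₂; [_,_])
open import Data.Vec using ([]; _∷_; lookup)
open import Data.Vec.Properties using ([]=⇒lookup; lookup⇒[]=)
open import Function using (_∘_)
open import Function.Bundles using (Equivalence)
open import Induction.WellFounded using (Acc; acc)
open import Relation.Binary.PropositionalEquality
  using (_≡_; _≢_; refl; sym; cong; cong₂; subst)
open import Relation.Nullary
  using (¬_; yes; no; contradiction; ¬?; _×-dec_; decidable-stable; map′)
open import Relation.Unary using (Decidable)

∣p∪q∣≤∣p∣+∣q∣ : ∀ {n} (p q : Subset n) → ∣ p ∪ q ∣ ≤ ∣ p ∣ + ∣ q ∣
∣p∪q∣≤∣p∣+∣q∣ []            []            = z≤n
∣p∪q∣≤∣p∣+∣q∣ (outside ∷ p) (outside ∷ q) = ∣p∪q∣≤∣p∣+∣q∣ p q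
∣p∪q∣≤∣p∣+∣q∣ (outside ∷ p) (inside  ∷ q) =
  ≤-trans (s≤s (∣p∪q∣≤∣p∣+∣q∣ p q)) (≤-reflexive (sym (+-suc ∣ p ∣ ∣ q ∣)))
∣p∪q∣≤∣p∣+∣q∣ (inside  ∷ p) (outside ∷ q) = s≤s (∣p∪q∣≤∣p∣+∣q∣ p q)
∣p∪q∣≤∣p∣+∣q∣ (inside  ∷ p) (inside  ∷ q) =
  s≤s (≤-trans (∣p∪q∣≤∣p∣+∣q∣ p q) (+-monoʳ-≤ ∣ p ∣ (n≤1+n ∣ q ∣)))

p⊆q∪r⇒∣p∣≤∣q∣+∣r∣ : ∀ {n} {p : Subset n} q r → p ⊆ q ∪ r → ∣ p ∣ ≤ ∣ q ∣ + ∣ r ∣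
p⊆q∪r⇒∣p∣≤∣q∣+∣r∣ q r p⊆q∪r = ≤-trans (p⊆q⇒∣p∣≤∣q∣ p⊆q∪r) (∣p∪q∣≤∣p∣+∣q∣ q r)

∣∅∩p∣≡0 : ∀ {n} (p : Subset n) → ∣ ∅ ∩ p ∣ ≡ 0
∣∅∩p∣≡0 {n} p = n≤0⇒n≡0 (≤-trans (∣p∩q∣≤∣p∣ ∅ p) (≤-reflexive (∣⊥∣≡0 n)))

Edge : ∀ {n} → DiGraph n → Fin n → Fin n → Set
Edge G u v = T (adj G u v)

module _ {n} {G : DiGraph n} where

  singleton : Fin n → DiPath G 0
  singleton x = record
    { vertex   = λ _ → x
    ; distinct = λ { {zero} {zero} _ → refl }
    ; edges    = λ ()
    }

  prepend : ∀ {m} x (P : DiPath G m) → Edge G x (start P) → (∀ i → x ≢ vertex P i)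
          → DiPath G (suc m)
  prepend {m} x P x→P x∉P = record { vertex = vertex′ ; distinct = distinct′ ; edges = edges′ }
    where
    vertex′ : Fin (suc (suc m)) → Fin n
    vertex′ zero    = x
    vertex′ (suc i) = vertex P i

    distinct′ : ∀ {i j} → vertex′ i ≡ vertex′ j → i ≡ j
    distinct′ {zero}  {zero}  _  = refl
    distinct′ {zero}  {suc j} eq = contradiction eq (x∉P j)
    distinct′ {suc i} {zero}  eq = contradiction (sym eq) (x∉P i)
    distinct′ {suc i} {suc j} eq = cong suc (distinct P eq)

    edges′ : (j : Fin (suc m)) → Edge G (vertex′ (inject₁ j)) (vertex′ (suc j))
    edges′ zero    = x→P
    edges′ (suc j) = edges P j

  linked⇒DiPath : ∀ m {x xs} → Linked (Edge G) (x ∷ xs) → Unique (x ∷ xs) → m ≤ length xs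
                → Σ[ P ∈ DiPath G m ] start P ≡ x × (∀ i → vertex P i ∈ₗ x ∷ xs)
  linked⇒DiPath zero    {x} _ _ _ = singleton x , refl , λ { zero → here refl }
  linked⇒DiPath (suc m) {x} {y ∷ xs} (x→y ∷ linked) (x∉ ∷ unique) (s≤s m≤)
    with linked⇒DiPath m linked unique m≤
  ... | P , refl , P⊆ =
    prepend x P x→y (λ i → All.lookup x∉ (P⊆ i)) ,
    refl ,
    λ { zero → here refl ; (suc i) → there (P⊆ i) }

fromList : ∀ {n} → List (Fin n) → Subset n
fromList = foldr (λ x p → ⁅ x ⁆ ∪ p) ∅

∉-fromList⇒All≢ : ∀ {n} {v : Fin n} xs → v ∉ fromList xs → All (v ≢_) xs
∉-fromList⇒All≢ []       _       = []
∉-fromList⇒All≢ (x ∷ xs) v∉x∷xs =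
  (λ { refl → v∉x∷xs (x∈p∪q⁺ (inj₁ (x∈⁅x⁆ x))) }) ∷ ∉-fromList⇒All≢ xs (v∉x∷xs ∘ x∈p∪q⁺ ∘ inj₂)

module _ {n} (B : Subset n) where

  ∣fromList-∷∩∣≤ : ∀ x xs → ∣ fromList (x ∷ xs) ∩ B ∣ ≤ suc ∣ fromList xs ∩ B ∣
  ∣fromList-∷∩∣≤ x xs = ≤-trans (p⊆q∪r⇒∣p∣≤∣q∣+∣r∣ ⁅ x ⁆ (fromList xs ∩ B) split)
                                (≤-reflexive (cong (_+ _) (∣⁅x⁆∣≡1 x)))
    where
    split : fromList (x ∷ xs) ∩ B ⊆ ⁅ x ⁆ ∪ (fromList xs ∩ B)
    split v∈ with x∈p∩q⁻ (fromList (x ∷ xs)) B v∈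
    ... | v∈x∷xs , v∈B with x∈p∪q⁻ ⁅ x ⁆ (fromList xs) v∈x∷xs
    ...   | inj₁ v∈x  = x∈p∪q⁺ (inj₁ v∈x)
    ...   | inj₂ v∈xs = x∈p∪q⁺ (inj₂ (x∈p∩q⁺ (v∈xs , v∈B)))

  ∉⇒∣fromList-∷∩∣≤ : ∀ x xs → x ∉ B → ∣ fromList (x ∷ xs) ∩ B ∣ ≤ ∣ fromList xs ∩ B ∣
  ∉⇒∣fromList-∷∩∣≤ x xs x∉B = p⊆q⇒∣p∣≤∣q∣ skip
    where
    skip : fromList (x ∷ xs) ∩ B ⊆ fromList xs ∩ B
    skip v∈ with x∈p∩q⁻ (fromList (x ∷ xs)) B v∈
    ... | v∈x∷xs , v∈B with x∈p∪q⁻ ⁅ x ⁆ (fromList xs) v∈x∷xs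
    ...   | inj₁ v∈x  = contradiction (subst (_∈ B) (x∈⁅y⁆⇒x≡y x v∈x) v∈B) x∉B
    ...   | inj₂ v∈xs = x∈p∩q⁺ (v∈xs , v∈B)

unvisited : ∀ {n} → Subset n → List (Fin n) → Subset n
unvisited S xs = ∁ (S ∪ fromList xs)

module _ {n} (S : Subset n) (xs : List (Fin n)) where

  ∈-unvisited⁺ : ∀ {v} → v ∉ S → v ∉ fromList xs → v ∈ unvisited S xs
  ∈-unvisited⁺ v∉S v∉xs = x∉p⇒x∈∁p ([ v∉S , v∉xs ] ∘ x∈p∪q⁻ S (fromList xs))

  ∈-unvisited⁻ : ∀ {v} → v ∈ unvisited S xs → v ∉ S × v ∉ fromList xs
  ∈-unvisited⁻ v∈U = x∈∁p⇒x∉p v∈U ∘ x∈p∪q⁺ ∘ inj₁ , x∈∁p⇒x∉p v∈U ∘ x∈p∪q⁺ ∘ inj₂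

module _ {n} (S : Subset n) (xs : List (Fin n)) where

  unvisited-∷⊆ : ∀ x → unvisited S (x ∷ xs) ⊆ unvisited S xs
  unvisited-∷⊆ x v∈U =
    let v∉S , v∉x∷xs = ∈-unvisited⁻ S (x ∷ xs) v∈U
    in ∈-unvisited⁺ S xs v∉S (v∉x∷xs ∘ x∈p∪q⁺ ∘ inj₂)

  ∈unvisited⇒∉unvisited-∷ : ∀ {x} → x ∈ unvisited S xs → x ∉ unvisited S (x ∷ xs)
  ∈unvisited⇒∉unvisited-∷ {x} _ x∈U =
    proj₂ (∈-unvisited⁻ S (x ∷ xs) x∈U) (x∈p∪q⁺ (inj₁ (x∈⁅x⁆ x)))

  unvisited-∪⁅⁆⊆ : ∀ x → unvisited (S ∪ ⁅ x ⁆) xs ⊆ unvisited S (x ∷ xs)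
  unvisited-∪⁅⁆⊆ x v∈U =
    let v∉S∪x , v∉xs = ∈-unvisited⁻ (S ∪ ⁅ x ⁆) xs v∈U
    in ∈-unvisited⁺ S (x ∷ xs) (v∉S∪x ∘ x∈p∪q⁺ ∘ inj₁)
                    ([ v∉S∪x ∘ x∈p∪q⁺ ∘ inj₂ , v∉xs ] ∘ x∈p∪q⁻ ⁅ x ⁆ (fromList xs))

  ∣B∣≤∣S∩B∣+∣xs∩B∣+∣unvisited∩B∣ : ∀ B
    → ∣ B ∣ ≤ ∣ S ∩ B ∣ + ∣ fromList xs ∩ B ∣ + ∣ unvisited S xs ∩ B ∣
  ∣B∣≤∣S∩B∣+∣xs∩B∣+∣unvisited∩B∣ B = ≤-trans
    (p⊆q∪r⇒∣p∣≤∣q∣+∣r∣ ((S ∩ B) ∪ (fromList xs ∩ B)) (unvisited S xs ∩ B) cover)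
    (+-monoˡ-≤ _ (∣p∪q∣≤∣p∣+∣q∣ (S ∩ B) (fromList xs ∩ B)))
    where
    cover : B ⊆ ((S ∩ B) ∪ (fromList xs ∩ B)) ∪ (unvisited S xs ∩ B)
    cover {v} v∈B with v ∈? S | v ∈? fromList xs
    ... | yes v∈S | _        = x∈p∪q⁺ (inj₁ (x∈p∪q⁺ (inj₁ (x∈p∩q⁺ (v∈S , v∈B)))))
    ... | no _    | yes v∈xs = x∈p∪q⁺ (inj₁ (x∈p∪q⁺ (inj₂ (x∈p∩q⁺ (v∈xs , v∈B)))))
    ... | no v∉S  | no v∉xs  = x∈p∪q⁺ (inj₂ (x∈p∩q⁺ (∈-unvisited⁺ S xs v∉S v∉xs , v∈B)))

Sparse : ∀ {n} → Subset n → Subset n → Set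
Sparse S W = 20 * ∣ S ∩ W ∣ < ∣ W ∣

no-room : ∀ a u c {b} → b ≤ a + u + c → 20 * a < b → 2 * u ≤ b → 20 * c < b → ⊥
no-room a u c {b} b≤ a< u≤ c< = <-irrefl refl (begin-strict
  20 * b                          ≤⟨ *-monoʳ-≤ 20 b≤ ⟩
  20 * (a + u + c)                ≡⟨ spread a u c ⟩
  20 * a + 10 * (2 * u) + 20 * c  <⟨ +-mono-<-≤ (+-mono-<-≤ a< (*-monoʳ-≤ 10 u≤)) (<⇒≤ c<) ⟩
  b + 10 * b + b                  ≡⟨ collect b ⟩
  12 * b                          ≤⟨ *-monoˡ-≤ b (m≤m+n 12 8) ⟩
  20 * b                          ∎)
  where
  open ≤-Reasoning
  spread : ∀ a u c → 20 * (a + u + c) ≡ 20 * a + 10 * (2 * u) + 20 * c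
  spread = solve-∀
  collect : ∀ b → b + 10 * b + b ≡ 12 * b
  collect = solve-∀

unvisited-dense : ∀ {n} S xs (B : Subset n) → Sparse S B → 2 * ∣ fromList xs ∩ B ∣ ≤ ∣ B ∣
                → ∣ B ∣ ≤ 20 * ∣ unvisited S xs ∩ B ∣
unvisited-dense S xs B sparse half = ≮⇒≥
  (no-room (∣ S ∩ B ∣) (∣ fromList xs ∩ B ∣) (∣ unvisited S xs ∩ B ∣)
           (∣B∣≤∣S∩B∣+∣xs∩B∣+∣unvisited∩B∣ S xs B) sparse half)

module _ {n} (S W : Subset n) where

  sparse⇒∃∉ : Sparse S W → ∃[ v ] v ∉ S
  sparse⇒∃∉ sparse with any? (λ v → ¬? (v ∈? S))
  ... | yes found = found
  ... | no none = ⊥-elim (<-irrefl refl (begin-strict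
    ∣ W ∣           ≤⟨ p⊆q⇒∣p∣≤∣q∣ W⊆S∩W ⟩
    ∣ S ∩ W ∣       ≤⟨ m≤n*m ∣ S ∩ W ∣ 20 ⟩
    20 * ∣ S ∩ W ∣  <⟨ sparse ⟩
    ∣ W ∣           ∎))
    where
    open ≤-Reasoning
    W⊆S∩W : W ⊆ S ∩ W
    W⊆S∩W {v} v∈W = x∈p∩q⁺ (decidable-stable (v ∈? S) (λ v∉S → none (v , v∉S)) , v∈W)

  ¬sparse-∪⁅⁆⇒∈ : ∀ {x} → Sparse S W → ¬ Sparse (S ∪ ⁅ x ⁆) W → x ∈ W
  ¬sparse-∪⁅⁆⇒∈ {x} sparse ¬sparse = decidable-stable (x ∈? W) λ x∉W →
    ¬sparse (≤-<-trans (*-monoʳ-≤ 20 (p⊆q⇒∣p∣≤∣q∣ (drop x∉W))) sparse)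
    where
    drop : x ∉ W → (S ∪ ⁅ x ⁆) ∩ W ⊆ S ∩ W
    drop x∉W v∈ with x∈p∩q⁻ (S ∪ ⁅ x ⁆) W v∈
    ... | v∈S∪x , v∈W with x∈p∪q⁻ S ⁅ x ⁆ v∈S∪x
    ...   | inj₁ v∈S = x∈p∩q⁺ (v∈S , v∈W)
    ...   | inj₂ v∈x = contradiction (subst (_∈ W) (x∈⁅y⁆⇒x≡y x v∈x) v∈W) x∉W

module DepthFirstSearch {n} (H : DiGraph n) (m : ℕ)
  (Small : Subset n → Set) (small? : Decidable Small)
  (small-∅ : Small ∅) (small⇒∃∉ : ∀ {S} → Small S → ∃[ v ] v ∉ S)
  where

  NoEdges : Subset n → Subset n → Set
  NoEdges A B = ∀ {u v} → u ∈ A → v ∈ B → ¬ Edge H u v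

  record State : Set where
    constructor state
    field
      done   : Subset n
      stack  : List (Fin n)
      linked : Linked (Edge H) stack
      unique : Unique stack
      small  : Small done
      closed : NoEdges (unvisited done stack) done

  open State

  potential : Subset n → List (Fin n) → ℕ
  potential S xs = 2 * ∣ unvisited S xs ∣ + length xs

  LongChain : Set
  LongChain = Σ[ xs ∈ List (Fin n) ] Linked (Edge H) xs × Unique xs × m < length xs

  record Stuck : Set where
    field
      done   : Subset n
      top    : Fin n
      rest   : List (Fin n)
      linked : Linked (Edge H) (top ∷ rest)
      short  : length (top ∷ rest) ≤ m
      small  : Small done
      dense  : ¬ Small (done ∪ ⁅ top ⁆)
      closed : NoEdges (unvisited done (top ∷ rest)) (done ∪ ⁅ top ⁆)

  push : (σ : State) (u : Fin n) → u ∈ unvisited (done σ) (stack σ)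
       → Linked (Edge H) (u ∷ stack σ) → State
  push (state S xs _ unique small closed) u u∈U linked = record
    { done   = S
    ; stack  = u ∷ xs
    ; linked = linked
    ; unique = ∉-fromList⇒All≢ xs (proj₂ (∈-unvisited⁻ S xs u∈U)) ∷ unique
    ; small  = small
    ; closed = closed ∘ unvisited-∷⊆ S xs u
    }

  push-decreases : ∀ S xs {u} → u ∈ unvisited S xs → potential S (u ∷ xs) < potential S xs
  push-decreases S xs {u} u∈U = begin
    suc (2 * ∣ unvisited S (u ∷ xs) ∣ + suc (length xs))
      ≡⟨ shift ∣ unvisited S (u ∷ xs) ∣ (length xs) ⟩
    2 * suc ∣ unvisited S (u ∷ xs) ∣ + length xs
      ≤⟨ +-monoˡ-≤ (length xs) (*-monoʳ-≤ 2 fewer) ⟩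
    2 * ∣ unvisited S xs ∣ + length xs
      ∎
    where
    open ≤-Reasoning
    shift : ∀ a l → suc (2 * a + suc l) ≡ 2 * suc a + l
    shift = solve-∀
    fewer : ∣ unvisited S (u ∷ xs) ∣ < ∣ unvisited S xs ∣
    fewer = p⊂q⇒∣p∣<∣q∣ (unvisited-∷⊆ S xs u , u , u∈U , ∈unvisited⇒∉unvisited-∷ S xs u∈U)

  closed-∪⁅⁆ : ∀ S xs x → NoEdges (unvisited S xs) S
             → ¬ (∃[ u ] u ∈ unvisited S xs × Edge H u x)
             → NoEdges (unvisited S xs) (S ∪ ⁅ x ⁆)
  closed-∪⁅⁆ S xs x closed none {u} u∈U v∈S∪x with x∈p∪q⁻ S ⁅ x ⁆ v∈S∪x
  ... | inj₁ v∈S = closed u∈U v∈S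
  ... | inj₂ v∈x rewrite x∈⁅y⁆⇒x≡y x v∈x = λ u→x → none (u , u∈U , u→x)

  pop : ∀ S x rest → Linked (Edge H) (x ∷ rest) → Unique (x ∷ rest) → Small (S ∪ ⁅ x ⁆)
      → NoEdges (unvisited S (x ∷ rest)) (S ∪ ⁅ x ⁆) → State
  pop S x rest linked unique small closed = record
    { done   = S ∪ ⁅ x ⁆
    ; stack  = rest
    ; linked = Linked.tail linked
    ; unique = AllPairs.tail unique
    ; small  = small
    ; closed = closed ∘ unvisited-∪⁅⁆⊆ S rest x
    }

  pop-decreases : ∀ S x rest → potential (S ∪ ⁅ x ⁆) rest < potential S (x ∷ rest)
  pop-decreases S x rest =
    +-mono-≤-< (*-monoʳ-≤ 2 (p⊆q⇒∣p∣≤∣q∣ (unvisited-∪⁅⁆⊆ S rest x))) (n<1+n (length rest))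

  dfs : (σ : State) → Acc _<_ (potential (done σ) (stack σ)) → LongChain ⊎ Stuck
  dfs σ@(state S [] _ _ small _) (acc more) =
    let v , v∉S = small⇒∃∉ small
        v∈U = ∈-unvisited⁺ S [] v∉S ∉⊥
    in dfs (push σ v v∈U [-]) (more (push-decreases S [] v∈U))
  dfs σ@(state S (x ∷ rest) linked unique small closed) (acc more) with m <? length (x ∷ rest)
  ... | yes long = inj₁ (x ∷ rest , linked , unique , long)
  ... | no ¬long with any? (λ u → (u ∈? unvisited S (x ∷ rest)) ×-dec T? (adj H u x))
  ...   | yes (u , u∈U , u→x) =
    dfs (push σ u u∈U (u→x ∷ linked)) (more (push-decreases S (x ∷ rest) u∈U))
  ...   | no none with small? (S ∪ ⁅ x ⁆)
  ...     | yes small′ =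
    dfs (pop S x rest linked unique small′ (closed-∪⁅⁆ S (x ∷ rest) x closed none))
        (more (pop-decreases S x rest))
  ...     | no dense = inj₂ (record
    { done   = S
    ; top    = x
    ; rest   = rest
    ; linked = linked
    ; short  = ≮⇒≥ ¬long
    ; small  = small
    ; dense  = dense
    ; closed = closed-∪⁅⁆ S (x ∷ rest) x closed none
    })

  longChain⊎stuck : LongChain ⊎ Stuck
  longChain⊎stuck =
    dfs (state ∅ [] [] [] small-∅ (λ _ v∈∅ → contradiction v∈∅ ∉⊥)) (<-wellFounded _)

∑-zero : ∀ {n} {f : Fin n → ℕ} → (∀ i → f i ≡ 0) → ∑ f ≡ 0
∑-zero {n} {f} f≡0 = go (allFin n)
  where
  go : ∀ is → foldr _+_ 0 (map f is) ≡ 0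
  go []       = refl
  go (i ∷ is) = cong₂ _+_ (f≡0 i) (go is)

module _ {n} {G : DiGraph n} where

  edgesFromTo≡0 : ∀ {X Y} → (∀ {u v} → u ∈ X → v ∈ Y → ¬ Edge G u v) → edgesFromTo G X Y ≡ 0
  edgesFromTo≡0 {X} {Y} none = ∑-zero λ u → ∑-zero λ v → indicator u v
    where
    indicator : ∀ u v → 𝟙 (lookup X u ∧ lookup Y v ∧ adj G u v) ≡ 0
    indicator u v with lookup X u in u∈X | lookup Y v in v∈Y | adj G u v in u→v
    ... | true  | true  | true  = contradiction (subst T (sym u→v) _)
                                    (none (lookup⇒[]= u X u∈X) (lookup⇒[]= v Y v∈Y))
    ... | true  | true  | false = refl
    ... | true  | false | _     = refl
    ... | false | _     | _     = refl

module _ {n} {G : DiGraph n} {A B : Subset n} where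

  IsRegularPair-sym : IsRegularPair G A B → IsRegularPair G B A
  IsRegularPair-sym regular X Y X⊆B Y⊆A B≤ A≤ =
    let eYX , eXY = regular Y X Y⊆A X⊆B A≤ B≤
    in subst (_≤ 10 * edgesFromTo G X Y) (*-comm ∣ Y ∣ ∣ X ∣) eXY ,
       subst (_≤ 10 * edgesFromTo G Y X) (*-comm ∣ Y ∣ ∣ X ∣) eYX

  regular⇒¬edgeless : IsRegularPair G A B → 0 < ∣ A ∣ → 0 < ∣ B ∣ → ∀ {X Y} → X ⊆ A → Y ⊆ B
                    → ∣ A ∣ ≤ 20 * ∣ X ∣ → ∣ B ∣ ≤ 20 * ∣ Y ∣
                    → ¬ (∀ {u v} → u ∈ Y → v ∈ X → ¬ Edge G u v)
  regular⇒¬edgeless regular A>0 B>0 {X} {Y} X⊆A Y⊆B A≤ B≤ none = contradiction (begin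
    1                        ≤⟨ *-mono-≤ (positive {m = ∣ X ∣} A>0 A≤)
                                         (positive {m = ∣ Y ∣} B>0 B≤) ⟩
    ∣ X ∣ * ∣ Y ∣            ≤⟨ proj₂ (regular X Y X⊆A Y⊆B A≤ B≤) ⟩
    10 * edgesFromTo G Y X   ≡⟨ cong (10 *_) (edgesFromTo≡0 none) ⟩
    0                        ∎) λ ()
    where
    open ≤-Reasoning
    positive : ∀ {w m} → 0 < w → w ≤ 20 * m → 0 < m
    positive {m = zero}  w>0 w≤0 = contradiction (≤-trans w>0 w≤0) λ ()
    positive {m = suc _} _   _   = z<s

2*m≤1+2*n⇒2*m≤2*n : ∀ m n → 2 * m ≤ suc (2 * n) → 2 * m ≤ 2 * n
2*m≤1+2*n⇒2*m≤2*n m n le with m≤n⇒m<n∨m≡n le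
... | inj₁ lt = m<1+n⇒m≤n lt
... | inj₂ eq = contradiction eq (even≢odd m n)

module Bipartition {n} (G : DiGraph n) (W₁ W₂ : Subset n) (disjoint : Disjoint W₁ W₂) where

  side : Bool → Subset n
  side true  = W₁
  side false = W₂

  side-disjoint : ∀ s {v} → v ∈ side s → v ∉ side (not s)
  side-disjoint true  v∈W₁      = disjoint _ v∈W₁
  side-disjoint false v∈W₂ v∈W₁ = disjoint _ v∈W₁ v∈W₂

  Crossing : Fin n → Fin n → Set
  Crossing u v = ∃[ s ] u ∈ side s × v ∈ side (not s)

  crossing-flips : ∀ {s u v} → u ∈ side s → Crossing u v → v ∈ side (not s)
  crossing-flips {true}  _    (true  , _    , v∈) = v∈
  crossing-flips {false} _    (false , _    , v∈) = v∈
  crossing-flips {true}  u∈W₁ (false , u∈W₂ , _)  = contradiction u∈W₂ (side-disjoint true u∈W₁)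
  crossing-flips {false} u∈W₂ (true  , u∈W₁ , _)  = contradiction u∈W₂ (side-disjoint true u∈W₁)

  between : DiGraph n
  between = record
    { adj = λ u v → adj G u v ∧ (lookup W₁ u ∧ lookup W₂ v ∨ lookup W₂ u ∧ lookup W₁ v) }

  private
    ∈⇒T : ∀ {v} {W : Subset n} → v ∈ W → T (lookup W v)
    ∈⇒T v∈W rewrite []=⇒lookup v∈W = _

    T⇒∈ : ∀ {v} (W : Subset n) → T (lookup W v) → v ∈ W
    T⇒∈ {v} W t with lookup W v in eq
    ... | true = lookup⇒[]= v W eq

  between-edge⁻ : ∀ {u v} → Edge between u v → Edge G u v × Crossing u v
  between-edge⁻ {u} {v} e with Equivalence.to T-∧ e
  ... | u→v , crossing = u→v , [ from₁₂ , from₂₁ ] (Equivalence.to T-∨ crossing)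
    where
    from₁₂ : T (lookup W₁ u ∧ lookup W₂ v) → Crossing u v
    from₁₂ t = let tu , tv = Equivalence.to T-∧ t in true , T⇒∈ W₁ tu , T⇒∈ W₂ tv
    from₂₁ : T (lookup W₂ u ∧ lookup W₁ v) → Crossing u v
    from₂₁ t = let tu , tv = Equivalence.to T-∧ t in false , T⇒∈ W₂ tu , T⇒∈ W₁ tv

  between-edge⁺ : ∀ {u v} → Edge G u v → Crossing u v → Edge between u v
  between-edge⁺ u→v (s , u∈ , v∈) =
    Equivalence.from T-∧ (u→v , Equivalence.from T-∨ (crossing s u∈ v∈))
    where
    crossing : ∀ {u v} s → u ∈ side s → v ∈ side (not s)
             → T (lookup W₁ u ∧ lookup W₂ v) ⊎ T (lookup W₂ u ∧ lookup W₁ v)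
    crossing true  u∈ v∈ = inj₁ (Equivalence.from T-∧ (∈⇒T u∈ , ∈⇒T v∈))
    crossing false u∈ v∈ = inj₂ (Equivalence.from T-∧ (∈⇒T u∈ , ∈⇒T v∈))

  between-linked⇒linked : ∀ {xs} → Linked (Edge between) xs → Linked (Edge G) xs
  between-linked⇒linked = Linked.map (proj₁ ∘ between-edge⁻)

  between-linked⇒crossing : ∀ {xs} → Linked (Edge between) xs → Linked Crossing xs
  between-linked⇒crossing = Linked.map (proj₂ ∘ between-edge⁻)

  occupancy : ∀ s {x xs} → x ∈ side s → Linked Crossing (x ∷ xs)
            → 2 * ∣ fromList (x ∷ xs) ∩ side (not s) ∣ ≤ length (x ∷ xs)
  occupancy s {x} {[]} x∈ [-] = ≤-trans (*-monoʳ-≤ 2 (begin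
    ∣ fromList (x ∷ []) ∩ side (not s) ∣
      ≤⟨ ∉⇒∣fromList-∷∩∣≤ (side (not s)) x [] (side-disjoint s x∈) ⟩
    ∣ ∅ ∩ side (not s) ∣
      ≡⟨ ∣∅∩p∣≡0 (side (not s)) ⟩
    0 ∎)) z≤n
    where open ≤-Reasoning
  occupancy s {x} {y ∷ []} x∈ (_ ∷ [-]) = *-monoʳ-≤ 2 (begin
    ∣ fromList (x ∷ y ∷ []) ∩ side (not s) ∣
      ≤⟨ ∉⇒∣fromList-∷∩∣≤ (side (not s)) x (y ∷ []) (side-disjoint s x∈) ⟩
    ∣ fromList (y ∷ []) ∩ side (not s) ∣
      ≤⟨ ∣fromList-∷∩∣≤ (side (not s)) y [] ⟩
    suc ∣ ∅ ∩ side (not s) ∣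
      ≡⟨ cong suc (∣∅∩p∣≡0 (side (not s))) ⟩
    1 ∎)
    where open ≤-Reasoning
  occupancy s {x} {y ∷ z ∷ xs} x∈ (x→y ∷ y→z ∷ linked) = begin
    2 * ∣ fromList (x ∷ y ∷ z ∷ xs) ∩ side (not s) ∣
      ≤⟨ *-monoʳ-≤ 2 (≤-trans (∉⇒∣fromList-∷∩∣≤ (side (not s)) x (y ∷ z ∷ xs) (side-disjoint s x∈))
                              (∣fromList-∷∩∣≤ (side (not s)) y (z ∷ xs))) ⟩
    2 * suc ∣ fromList (z ∷ xs) ∩ side (not s) ∣
      ≡⟨ *-suc 2 _ ⟩
    2 + 2 * ∣ fromList (z ∷ xs) ∩ side (not s) ∣
      ≤⟨ +-monoʳ-≤ 2 (occupancy s z∈ linked) ⟩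
    2 + length (z ∷ xs)
      ∎
    where
    open ≤-Reasoning
    z∈ : z ∈ side s
    z∈ = subst (λ t → z ∈ side t) (not-involutive s)
               (crossing-flips (crossing-flips x∈ x→y) y→z)

  Small : Subset n → Set
  Small S = ∀ s → Sparse S (side s)

  small? : Decidable Small
  small? S = map′ (λ (sparse₁ , sparse₂) → λ { true → sparse₁ ; false → sparse₂ })
                  (λ small → small true , small false)
                  (20 * ∣ S ∩ W₁ ∣ <? ∣ W₁ ∣ ×-dec 20 * ∣ S ∩ W₂ ∣ <? ∣ W₂ ∣)

  small⇒∃∉ : ∀ {S} → Small S → ∃[ v ] v ∉ S
  small⇒∃∉ {S} small = sparse⇒∃∉ S W₁ (small true)

  ¬small⇒dense-side : ∀ {S} → ¬ Small S → ∃[ s ] ¬ Sparse S (side s)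
  ¬small⇒dense-side {S} ¬small with 20 * ∣ S ∩ W₁ ∣ <? ∣ W₁ ∣
  ... | no ¬sparse₁ = true , ¬sparse₁
  ... | yes sparse₁ = false , λ sparse₂ → ¬small λ { true → sparse₁ ; false → sparse₂ }

module LongPaths {n} (G : DiGraph n) (W₁ W₂ : Subset n) (disjoint : Disjoint W₁ W₂)
  (k : ℕ) (k≥1 : 1 ≤ k) (|W₁|≥2k : 2 * k ≤ ∣ W₁ ∣) (|W₂|≥2k : 2 * k ≤ ∣ W₂ ∣)
  (regular : IsRegularPair G W₁ W₂)
  where

  open Bipartition G W₁ W₂ disjoint

  large : ∀ s → 2 * k ≤ ∣ side s ∣
  large true  = |W₁|≥2k
  large false = |W₂|≥2k

  nonempty : ∀ s → 0 < ∣ side s ∣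
  nonempty s = ≤-trans (≤-trans k≥1 (m≤n*m k 2)) (large s)

  regular-side : ∀ s → IsRegularPair G (side s) (side (not s))
  regular-side true  = regular
  regular-side false = IsRegularPair-sym regular

  small-∅ : Small ∅
  small-∅ s = subst (λ c → 20 * c < ∣ side s ∣) (sym (∣∅∩p∣≡0 (side s))) (nonempty s)

  open DepthFirstSearch between (suc (2 * k)) Small small? small-∅ small⇒∃∉

  stuck-impossible : ¬ Stuck
  stuck-impossible stuck = regular⇒¬edgeless (regular-side s) (nonempty s) (nonempty (not s))
    (p∩q⊆q _ _) (p∩q⊆q _ _) (≮⇒≥ ¬sparse)
    (unvisited-dense done (top ∷ rest) (side (not s)) (small (not s)) half)
    no-edge
    where
    open Stuck stuck
    dense-side : ∃[ s ] ¬ Sparse (done ∪ ⁅ top ⁆) (side s)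
    dense-side = ¬small⇒dense-side {S = done ∪ ⁅ top ⁆} dense
    s = proj₁ dense-side
    ¬sparse = proj₂ dense-side

    half : 2 * ∣ fromList (top ∷ rest) ∩ side (not s) ∣ ≤ ∣ side (not s) ∣
    half = ≤-trans (2*m≤1+2*n⇒2*m≤2*n ∣ fromList (top ∷ rest) ∩ side (not s) ∣ k (≤-trans
             (occupancy s (¬sparse-∪⁅⁆⇒∈ done (side s) (small s) ¬sparse)
                          (between-linked⇒crossing linked))
             short))
           (large (not s))

    no-edge : ∀ {u v} → u ∈ unvisited done (top ∷ rest) ∩ side (not s)
            → v ∈ (done ∪ ⁅ top ⁆) ∩ side s → ¬ Edge G u v
    no-edge {u} {v} u∈ v∈ u→v =
      let u∈U , u∈W = x∈p∩q⁻ (unvisited done (top ∷ rest)) (side (not s)) u∈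
          v∈D , v∈W = x∈p∩q⁻ (done ∪ ⁅ top ⁆) (side s) v∈
      in closed u∈U v∈D (between-edge⁺ u→v
           (not s , u∈W , subst (λ t → v ∈ side t) (sym (not-involutive s)) v∈W))

  PathFrom : Subset n → Set
  PathFrom W = Σ[ P ∈ DiPath G (2 * k) ] start P ∈ W

  chain⇒PathFrom : ∀ {W x xs} → x ∈ W → Linked (Edge between) (x ∷ xs) → Unique (x ∷ xs)
                 → 2 * k ≤ length xs → PathFrom W
  chain⇒PathFrom {W} x∈W linked unique long =
    let P , start≡x , _ = linked⇒DiPath (2 * k) (between-linked⇒linked linked) unique long
    in P , subst (_∈ W) (sym start≡x) x∈W

  both-sides : ∀ s → PathFrom (side s) → PathFrom (side (not s)) → PathFrom W₁ × PathFrom W₂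
  both-sides true  P Q = P , Q
  both-sides false P Q = Q , P

  long-chain⇒paths : LongChain → PathFrom W₁ × PathFrom W₂
  long-chain⇒paths (x ∷ y ∷ rest , x→y ∷ linked , x∉ ∷ unique , s≤s (s≤s long)) =
    let s , x∈ , y∈ = proj₂ (between-edge⁻ x→y)
    in both-sides s (chain⇒PathFrom x∈ (x→y ∷ linked) (x∉ ∷ unique) (m≤n⇒m≤1+n long))
                    (chain⇒PathFrom y∈ linked unique long)

  paths : PathFrom W₁ × PathFrom W₂
  paths with longChain⊎stuck
  ... | inj₁ chain = long-chain⇒paths chain
  ... | inj₂ stuck = ⊥-elim (stuck-impossible stuck)

lemma2p2 : (k : ℕ) → 1 ≤ k → (n : ℕ) → (G : DiGraph n) → (W₁ W₂ : Subset n)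
    → Disjoint W₁ W₂ → 2 * k ≤ ∣ W₁ ∣ → 2 * k ≤ ∣ W₂ ∣
    → IsRegularPair G W₁ W₂
    → Σ (DiPath G (2 * k)) (λ P → start P ∈ W₁)
      × Σ (DiPath G (2 * k)) (λ P → start P ∈ W₂)
lemma2p2 k k≥1 n G W₁ W₂ disjoint |W₁|≥2k |W₂|≥2k regular =
  LongPaths.paths G W₁ W₂ disjoint k k≥1 |W₁|≥2k |W₂|≥2k regular
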